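{- For any positive integer $k$, put $q(k)=324k^4 +216 k^3 +84k^2 +16k -1$. Then for every integer $k \geq 1$, \begin{equation*} \frac{1}{q(k)+0.99}-\frac{1}{q(k+1)+0.99}< \frac{1}{(3k+1)^5}+\frac{1}{(3k+2)^5}+\frac{1}{(3k+3)^5}<\frac{1}{q(k)}-\frac{1}{q(k+1)}. \end{equation*} -}

module Defs where

open import Data.Nat using (ℕ; zero; suc; _+_; _*_; _∸_; _^_)
open import Data.Integer using (+_)
open import Data.Rational using (ℚ; _/_; 0ℚ)

-- q(k) = 324k^4 + 216k^3 + 84k^2 + 16k - 1, as a natural number.
-- For k ≥ 1 the value is ≥ 639 > 0, so truncated subtraction is exact there.
q : ℕ → ℕ
q k = 324 * k ^ 4 + 216 * k ^ 3 + 84 * k ^ 2 + 16 * k ∸ 1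

-- reciprocal 1/n of a natural number as a rational (only used for n > 0;
-- the value at 0 is an irrelevant convention)
recip : ℕ → ℚ
recip zero    = 0ℚ
recip (suc n) = + 1 / suc n

-- 1 / (n + 0.99) = 100 / (100 n + 99), exact rational value
recip99 : ℕ → ℚ
recip99 n = + 100 / suc (100 * n + 98)

{-# OPTIONS --safe #-}
module Submission where

-- Clearing denominators turns each inequality into a polynomial inequality in k.
-- Substituting k = j + 1, the larger side exceeds the smaller one by 1 + G(j), where
-- G is an explicit polynomial of degree 14 with nonnegative coefficients; the
-- resulting polynomial identity is checked by the semiring normaliser. The passage
-- from ℚ to ℕ goes through unnormalised rationals, where < is cross-multiplication.

open import Defs
open import Data.Nat as ℕ using (ℕ; suc; _+_; _*_; _^_; _∸_; _≤_; NonZero)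
open import Data.Nat.Properties using (≤-trans; ≤-reflexive; m≤m+n)
open import Data.Nat.Solver using (module +-*-Solver)
open import Data.Integer as ℤ using (ℤ; +_; +<+)
import Data.Integer.Properties as ℤ
import Data.Integer.Solver as ℤ-Solver
open import Data.List using (List; []; _∷_)
open import Data.Product using (_×_; _,_)
open import Data.Rational using (_<_; _-_; toℚᵘ) renaming (_+_ to _+ℚ_)
open import Data.Rational.Properties using (toℚᵘ-fromℚᵘ; toℚᵘ-homo-+; toℚᵘ-homo‿-; toℚᵘ-cancel-<)
open import Data.Rational.Unnormalised as ℚᵘ using (ℚᵘ; mkℚᵘ; ↥_; ↧_; *<*)
import Data.Rational.Unnormalised.Properties as ℚᵘ
open import Algebra.Properties.AbelianGroup ℤ.+-0-abelianGroup using (//-rightDividesʳ)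
open import Relation.Binary.PropositionalEquality

-- 1/x + 1/y + 1/z = e₂ x y z / (x * y * z), bracketed the way ℚᵘ addition computes it.
e₂ : ℕ → ℕ → ℕ → ℕ
e₂ x y z = (y + x) * z + x * y

*<*-balanced : ∀ {p q : ℚᵘ} {k l : ℕ} →
  ↥ p ℤ.* ↧ q ℤ.+ + k ≡ ↥ q ℤ.* ↧ p ℤ.+ + l → l ℕ.< k → p ℚᵘ.< q
*<*-balanced {p} {q} {k} {l} balance l<k = *<* (begin-strict
  a                 ≡⟨ //-rightDividesʳ (+ l) a ⟨
  a ℤ.+ + l ℤ.- + l <⟨ ℤ.+-monoˡ-< (ℤ.- + l) a+l<b+l ⟩
  b ℤ.+ + l ℤ.- + l ≡⟨ //-rightDividesʳ (+ l) b ⟩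
  b                 ∎)
  where
  open ℤ.≤-Reasoning
  a = ↥ p ℤ.* ↧ q
  b = ↥ q ℤ.* ↧ p
  a+l<b+l : a ℤ.+ + l ℤ.< b ℤ.+ + l
  a+l<b+l = subst (a ℤ.+ + l ℤ.<_) balance (ℤ.+-monoʳ-< a (+<+ l<k))

-- Cross-multiplying 1/x + 1/y + 1/z against c/m - c/n, with both sides shifted so
-- that the negative term of c/m - c/n no longer occurs in the comparison.
unitFractions-fracDiff-balance : ∀ (c x y z m n : ℤ) →
  ((+ 1 ℤ.* y ℤ.+ + 1 ℤ.* x) ℤ.* z ℤ.+ + 1 ℤ.* (x ℤ.* y)) ℤ.* (m ℤ.* n) ℤ.+ c ℤ.* n ℤ.* (x ℤ.* y ℤ.* z)
  ≡ (c ℤ.* n ℤ.+ ℤ.- c ℤ.* m) ℤ.* (x ℤ.* y ℤ.* z)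
    ℤ.+ (((y ℤ.+ x) ℤ.* z ℤ.+ x ℤ.* y) ℤ.* m ℤ.* n ℤ.+ c ℤ.* m ℤ.* (x ℤ.* y ℤ.* z))
unitFractions-fracDiff-balance = solve 6 (λ c x y z m n →
  ((con (+ 1) :* y :+ con (+ 1) :* x) :* z :+ con (+ 1) :* (x :* y)) :* (m :* n) :+ c :* n :* (x :* y :* z)
  := (c :* n :+ :- c :* m) :* (x :* y :* z)
     :+ (((y :+ x) :* z :+ x :* y) :* m :* n :+ c :* m :* (x :* y :* z))) refl
  where open ℤ-Solver.+-*-Solver

-- Matching every argument against suc makes the ℤ products in the balance identity
-- compute to the ℕ products of the hypothesis.
unitFractions<fracDiff : ∀ c x y z m n .{{_ : NonZero c}} .{{_ : NonZero x}} .{{_ : NonZero y}}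
  .{{_ : NonZero z}} .{{_ : NonZero m}} .{{_ : NonZero n}} →
  e₂ x y z * m * n + c * m * (x * y * z) ℕ.< c * n * (x * y * z) →
  + 1 ℚᵘ./ x ℚᵘ.+ + 1 ℚᵘ./ y ℚᵘ.+ + 1 ℚᵘ./ z ℚᵘ.< + c ℚᵘ./ m ℚᵘ.- + c ℚᵘ./ n
unitFractions<fracDiff c@(suc _) x@(suc _) y@(suc _) z@(suc _) m@(suc _) n@(suc _) =
  *<*-balanced (unitFractions-fracDiff-balance (+ c) (+ x) (+ y) (+ z) (+ m) (+ n))

fracDiff<unitFractions : ∀ c x y z m n .{{_ : NonZero c}} .{{_ : NonZero x}} .{{_ : NonZero y}}
  .{{_ : NonZero z}} .{{_ : NonZero m}} .{{_ : NonZero n}} →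
  c * n * (x * y * z) ℕ.< e₂ x y z * m * n + c * m * (x * y * z) →
  + c ℚᵘ./ m ℚᵘ.- + c ℚᵘ./ n ℚᵘ.< + 1 ℚᵘ./ x ℚᵘ.+ + 1 ℚᵘ./ y ℚᵘ.+ + 1 ℚᵘ./ z
fracDiff<unitFractions c@(suc _) x@(suc _) y@(suc _) z@(suc _) m@(suc _) n@(suc _) =
  *<*-balanced (sym (unitFractions-fracDiff-balance (+ c) (+ x) (+ y) (+ z) (+ m) (+ n)))

toℚᵘ-recip : ∀ x .{{_ : NonZero x}} → toℚᵘ (recip x) ℚᵘ.≃ + 1 ℚᵘ./ x
toℚᵘ-recip (suc x) = toℚᵘ-fromℚᵘ (mkℚᵘ (+ 1) x)

toℚᵘ-recip99 : ∀ m → toℚᵘ (recip99 m) ℚᵘ.≃ + 100 ℚᵘ./ suc (100 * m + 98)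
toℚᵘ-recip99 m = toℚᵘ-fromℚᵘ (mkℚᵘ (+ 100) (100 * m + 98))

toℚᵘ-recip-sum : ∀ x y z .{{_ : NonZero x}} .{{_ : NonZero y}} .{{_ : NonZero z}} →
  toℚᵘ (recip x +ℚ recip y +ℚ recip z) ℚᵘ.≃ + 1 ℚᵘ./ x ℚᵘ.+ + 1 ℚᵘ./ y ℚᵘ.+ + 1 ℚᵘ./ z
toℚᵘ-recip-sum x y z = ℚᵘ.≃-trans (toℚᵘ-homo-+ (recip x +ℚ recip y) (recip z))
  (ℚᵘ.+-cong (ℚᵘ.≃-trans (toℚᵘ-homo-+ (recip x) (recip y)) (ℚᵘ.+-cong (toℚᵘ-recip x) (toℚᵘ-recip y)))
             (toℚᵘ-recip z))

toℚᵘ-sub : ∀ {p q u v} → toℚᵘ p ℚᵘ.≃ u → toℚᵘ q ℚᵘ.≃ v → toℚᵘ (p - q) ℚᵘ.≃ u ℚᵘ.- v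
toℚᵘ-sub {p} {q} p≃u q≃v = ℚᵘ.≃-trans (toℚᵘ-homo-+ p (Data.Rational.- q))
  (ℚᵘ.+-cong p≃u (ℚᵘ.≃-trans (toℚᵘ-homo‿- q) (ℚᵘ.-‿cong q≃v)))

recip-sum<recip-diff : ∀ x y z m n .{{_ : NonZero x}} .{{_ : NonZero y}} .{{_ : NonZero z}}
  .{{_ : NonZero m}} .{{_ : NonZero n}} →
  e₂ x y z * m * n + 1 * m * (x * y * z) ℕ.< 1 * n * (x * y * z) →
  recip x +ℚ recip y +ℚ recip z < recip m - recip n
recip-sum<recip-diff x y z m n ineq = toℚᵘ-cancel-<
  (ℚᵘ.<-respˡ-≃ (ℚᵘ.≃-sym (toℚᵘ-recip-sum x y z))
  (ℚᵘ.<-respʳ-≃ (ℚᵘ.≃-sym (toℚᵘ-sub (toℚᵘ-recip m) (toℚᵘ-recip n)))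
  (unitFractions<fracDiff 1 x y z m n ineq)))

recip99-diff<recip-sum : ∀ x y z m n .{{_ : NonZero x}} .{{_ : NonZero y}} .{{_ : NonZero z}} →
  let m′ = suc (100 * m + 98); n′ = suc (100 * n + 98) in
  100 * n′ * (x * y * z) ℕ.< e₂ x y z * m′ * n′ + 100 * m′ * (x * y * z) →
  recip99 m - recip99 n < recip x +ℚ recip y +ℚ recip z
recip99-diff<recip-sum x y z m n ineq = toℚᵘ-cancel-<
  (ℚᵘ.<-respʳ-≃ (ℚᵘ.≃-sym (toℚᵘ-recip-sum x y z))
  (ℚᵘ.<-respˡ-≃ (ℚᵘ.≃-sym (toℚᵘ-sub (toℚᵘ-recip99 m) (toℚᵘ-recip99 n)))
  (fracDiff<unitFractions 100 x y z _ _ ineq)))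

1+m+n≡o⇒m<o : ∀ {m n o} → suc m + n ≡ o → m ℕ.< o
1+m+n≡o⇒m<o eq = ≤-trans (m≤m+n _ _) (≤-reflexive eq)

open +-*-Solver using (Polynomial; solve; con; _:+_; _:*_; _:^_; _:=_)

qSuc : ℕ → ℕ
qSuc j = 324 * suc j ^ 4 + 216 * suc j ^ 3 + 84 * suc j ^ 2 + 16 * j + 15

qSucᴾ : Polynomial 1 → Polynomial 1
qSucᴾ j = con 324 :* (con 1 :+ j) :^ 4 :+ con 216 :* (con 1 :+ j) :^ 3 :+ con 84 :* (con 1 :+ j) :^ 2
          :+ con 16 :* j :+ con 15

q-suc : ∀ j → q (suc j) ≡ qSuc j
q-suc j = cong (_∸ 1) (solve 1 (λ j → let k = con 1 :+ j in
  con 324 :* k :^ 4 :+ con 216 :* k :^ 3 :+ con 84 :* k :^ 2 :+ con 16 :* k := con 1 :+ qSucᴾ j) refl j)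

fifthPowerᴾ : ℕ → Polynomial 1 → Polynomial 1
fifthPowerᴾ r k = (con 3 :* k :+ con r) :^ 5

hornerᴾ : List ℕ → Polynomial 1 → Polynomial 1
hornerᴾ []       t = con 0
hornerᴾ (c ∷ cs) t = con c :+ t :* hornerᴾ cs t

-- In both certificates the coefficient list is G, the excess of the larger side
-- over the smaller one minus 1, expanded in j = k - 1 (lowest degree first).
upper-bound-cross-multiplied : ∀ j →
  let k = suc j; x = (3 * k + 1) ^ 5; y = (3 * k + 2) ^ 5; z = (3 * k + 3) ^ 5; m = qSuc j; n = qSuc k in
  e₂ x y z * m * n + 1 * m * (x * y * z) ℕ.< 1 * n * (x * y * z)
upper-bound-cross-multiplied j = 1+m+n≡o⇒m<o (solve 1 (λ j →
  let k = con 1 :+ j; x = fifthPowerᴾ 1 k; y = fifthPowerᴾ 2 k; z = fifthPowerᴾ 3 k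
      m = qSucᴾ j; n = qSucᴾ k
      G = hornerᴾ (277818778655 ∷ 2067004277680 ∷ 7193993768704 ∷ 15533126937240 ∷ 23255604805086 ∷
                   25547303406420 ∷ 21241266796242 ∷ 13581630145440 ∷ 6711805898658 ∷ 2551456223550 ∷
                   734554686213 ∷ 155331937440 ∷ 22812282072 ∷ 2083248720 ∷ 89282088 ∷ []) j
  in con 1 :+ (((y :+ x) :* z :+ x :* y) :* m :* n :+ con 1 :* m :* (x :* y :* z)) :+ G
     := con 1 :* n :* (x :* y :* z)) refl j)

lower-bound-cross-multiplied : ∀ j →
  let k = suc j; x = (3 * k + 1) ^ 5; y = (3 * k + 2) ^ 5; z = (3 * k + 3) ^ 5
      m = suc (100 * qSuc j + 98); n = suc (100 * qSuc k + 98) in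
  100 * n * (x * y * z) ℕ.< e₂ x y z * m * n + 100 * m * (x * y * z)
lower-bound-cross-multiplied j = 1+m+n≡o⇒m<o (solve 1 (λ j →
  let k = con 1 :+ j; x = fifthPowerᴾ 1 k; y = fifthPowerᴾ 2 k; z = fifthPowerᴾ 3 k
      m = con 1 :+ (con 100 :* qSucᴾ j :+ con 98); n = con 1 :+ (con 100 :* qSucᴾ k :+ con 98)
      G = hornerᴾ (2011045254623 ∷ 823508009560400 ∷ 5522077417829120 ∷ 17226551404266600 ∷
                   32987588443007490 ∷ 43264023822708300 ∷ 41063258047408830 ∷ 29038309276687200 ∷
                   15501326528513790 ∷ 6250203683352450 ∷ 1880747549241147 ∷ 410605960752000 ∷
                   61583524797600 ∷ 5684292936000 ∷ 243612554400 ∷ []) j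
  in con 1 :+ con 100 :* n :* (x :* y :* z) :+ G
     := ((y :+ x) :* z :+ x :* y) :* m :* n :+ con 100 :* m :* (x :* y :* z)) refl j)

lemma3p2 : (k : ℕ) → 1 ≤ k →
    (recip99 (q k) - recip99 (q (suc k))
       < recip ((3 * k + 1) ^ 5) +ℚ recip ((3 * k + 2) ^ 5) +ℚ recip ((3 * k + 3) ^ 5))
    × (recip ((3 * k + 1) ^ 5) +ℚ recip ((3 * k + 2) ^ 5) +ℚ recip ((3 * k + 3) ^ 5)
       < recip (q k) - recip (q (suc k)))
lemma3p2 k@(suc j) _ =
  subst₂ (λ m n → (recip99 m - recip99 n < S) × (S < recip m - recip n)) (sym (q-suc j)) (sym (q-suc k))
    ( recip99-diff<recip-sum x y z (qSuc j) (qSuc k) (lower-bound-cross-multiplied j)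
    , recip-sum<recip-diff x y z (qSuc j) (qSuc k) (upper-bound-cross-multiplied j))
  where
  x = (3 * k + 1) ^ 5
  y = (3 * k + 2) ^ 5
  z = (3 * k + 3) ^ 5
  S = recip x +ℚ recip y +ℚ recip z
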